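{- For all integers $n \ge m \ge 2$, the outcome of the Maker-Breaker domination game on the grid $P_m \square P_n$ is $\mathcal{D}$, i.e., Dominator has a winning strategy both in the D-game and in the S-game on $P_m \square P_n$.
   Context: The Maker-Breaker domination game on a finite graph $G$ is played by two players, Dominator and Staller, who alternately select (claim) a previously unplayed vertex of $G$ until all vertices are played. Dominator wins if the set of vertices he claimed is a dominating set of $G$ (every vertex is in it or adjacent to a vertex in it); otherwise Staller wins, equivalently Staller wins iff she claims all vertices of some closed neighborhood $N_G[v]=\{v\}\cup N_G(v)$. The game is a D-game if Dominator makes the first move and an S-game if Staller makes the first move. The outcome $o(G)$ is $\mathcal{D}$ if Dominator has a winning strategy in both the D-game and the S-game, $\mathcal{S}$ if Staller has a winning strategy in both games, and $\mathcal{N}$ if the first player has a winning strategy in each game. $P_k$ denotes the path on $k$ vertices and $G \square H$ the Cartesian product of graphs $G$ and $H$ (vertex set $V(G)\times V(H)$, with $(g,h)\sim(g',h')$ iff either $gg'\in E(G)$ and $h=h'$, or $g=g'$ and $hh'\in E(H)$). -}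

module Defs where

open import Data.Nat using (ℕ; suc; _+_)
open import Data.Fin using (Fin; toℕ)
open import Data.Product using (_×_; Σ; ∃; _,_)
open import Data.Product.Properties using (≡-dec)
open import Data.Sum using (_⊎_)
open import Relation.Binary.PropositionalEquality using (_≡_)
open import Relation.Binary.Definitions using (DecidableEquality)
open import Relation.Nullary using (yes; no)
import Data.Fin as Fin

record Graph : Set₁ where
  field
    V   : Set
    _≟V_ : DecidableEquality V
    Adj : V → V → Set


data Cell : Set where
  free : Cell
  dom  : Cell
  sta  : Cell

data Player : Set where
  Dominator Staller : Player

module Game (G : Graph) where
  open Graph G renaming (V to Vx)

  State : Set
  State = Vx → Cell

  empty : State
  empty _ = free

  claim : State → Vx → Cell → State
  claim s v c u with u ≟V v
  ... | yes _ = c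
  ... | no  _ = s u

  AllPlayed : State → Set
  AllPlayed s = ∀ v → s v ≡ free → Data.Empty.⊥
    where import Data.Empty

  Dominated : State → Set
  Dominated s = ∀ v → (s v ≡ dom) ⊎ (Σ Vx λ u → Adj v u × s u ≡ dom)

  data DomWins (s : State) : Player → Set where
    finished : ∀ {p} → AllPlayed s → Dominated s → DomWins s p
    dmove    : (v : Vx) → s v ≡ free → DomWins (claim s v dom) Staller
             → DomWins s Dominator
    smove    : (Σ Vx λ v → s v ≡ free)
             → (∀ v → s v ≡ free → DomWins (claim s v sta) Dominator)
             → DomWins s Staller

  -- Outcome 𝒟: Dominator wins both the D-game and the S-game.
  OutcomeD : Set
  OutcomeD = DomWins empty Dominator × DomWins empty Staller

PathAdj : ∀ {k} → Fin k → Fin k → Set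
PathAdj i j = (suc (toℕ i) ≡ toℕ j) ⊎ (suc (toℕ j) ≡ toℕ i)

Grid : ℕ → ℕ → Graph
Grid m n = record
  { V = Fin m × Fin n
  ; _≟V_ = ≡-dec Fin._≟_ Fin._≟_
  ; Adj = λ { (g , h) (g' , h') → (PathAdj g g' × h ≡ h') ⊎ (g ≡ g' × PathAdj h h') }
  }

OutcomeIsD : Graph → Set
OutcomeIsD G = Game.OutcomeD G

-- A pairing strategy wins for Dominator: if the vertices are matched into adjacent
-- pairs and he answers each Staller move on its partner, every pair ends up containing
-- one of his vertices, so he dominates the graph. If m or n is even, P_m □ P_n has a
-- perfect matching into adjacent pairs. If both are odd, removing the 3 × 3 corner
-- leaves a grid that still has one (the rows below the corner pair up vertically, the
-- rest of the first three rows horizontally), and Dominator wins the corner separately: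
-- after Staller's first move K there he claims a fixed answer to K and then pairs up
-- six of the remaining corner vertices so that every corner vertex is dominated by his
-- answer or lies near both vertices of one pair. Each strategy is phrased as an
-- invariant of positions that also survives arbitrary extra Dominator moves, which is
-- why it wins both the D-game and the S-game.

module Submission where

open import Defs
open import Data.Nat using (ℕ; zero; suc; _+_; _≤_; _<_; z≤n; s≤s)
open import Data.Nat.Properties
  using (≤-refl; ≤-reflexive; ≤-trans; <-irrefl; <-trans; <-≤-trans; +-mono-≤; +-mono-<-≤; +-mono-≤-<)
open import Data.Fin using (Fin; zero; suc; toℕ; _↑ˡ_)
import Data.Fin as Fin
import Data.Nat as ℕ
open import Data.List using (List; []; _∷_; foldr)
open import Data.Fin.Patterns using (0F; 1F; 2F)
open import Data.Fin.Properties using (any?; all?; suc-injective; toℕ-↑ˡ; ↑ˡ-injective)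
open import Data.Empty using (⊥; ⊥-elim)
open import Data.Unit using (⊤; tt)
open import Data.Product using (_×_; Σ; Σ-syntax; _,_; proj₁; proj₂)
open import Data.Sum using (_⊎_; inj₁; inj₂)
open import Function using (_∘_; id)
open import Relation.Nullary using (Dec; yes; no; ¬?)
open import Relation.Nullary.Decidable using (map′; from-yes; _×-dec_; _⊎-dec_)
open import Relation.Binary.PropositionalEquality
  using (_≡_; _≢_; _≗_; refl; sym; trans; cong; cong₂; subst; subst₂)

data Safe : Cell → Cell → Set where
  domˡ      : ∀ {c} → Safe dom c
  domʳ      : ∀ {c} → Safe c dom
  free-free : Safe free free

safe-domˡ : ∀ {c d} → c ≡ dom → Safe c d
safe-domˡ refl = domˡ

safe-domʳ : ∀ {c d} → d ≡ dom → Safe c d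
safe-domʳ refl = domʳ

safe-non-sta : ∀ {c d} → c ≢ sta → d ≢ sta → Safe c d
safe-non-sta {dom}  {d}    _ _ = domˡ
safe-non-sta {c}    {dom}  _ _ = domʳ
safe-non-sta {free} {free} _ _ = free-free
safe-non-sta {sta}  {_}    c≢sta _ = ⊥-elim (c≢sta refl)
safe-non-sta {_}    {sta}  _ d≢sta = ⊥-elim (d≢sta refl)

safe-played : ∀ {c d} → Safe c d → c ≢ free → d ≢ free → c ≡ dom ⊎ d ≡ dom
safe-played domˡ      _ _ = inj₁ refl
safe-played domʳ      _ _ = inj₂ refl
safe-played free-free c≢free _ = ⊥-elim (c≢free refl)

module Strategy (G : Graph) where
  open Graph G
  open Game G

  claim-≡ : ∀ s {v} c {u} → u ≡ v → claim s v c u ≡ c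
  claim-≡ s {v} c {u} u≡v with u ≟V v
  ... | yes _   = refl
  ... | no u≢v = ⊥-elim (u≢v u≡v)

  claim-≢ : ∀ s {v} c {u} → u ≢ v → claim s v c u ≡ s u
  claim-≢ s {v} c {u} u≢v with u ≟V v
  ... | yes u≡v = ⊥-elim (u≢v u≡v)
  ... | no _    = refl

  claim-cong : ∀ {s s'} → s ≗ s' → ∀ v c → claim s v c ≗ claim s' v c
  claim-cong s≗s' v c u with u ≟V v
  ... | yes _ = refl
  ... | no _  = s≗s' u

  claim-comm : ∀ s {v w} c d → v ≢ w → claim (claim s v c) w d ≗ claim (claim s w d) v c
  claim-comm s {v} {w} c d v≢w u = by-cases (u ≟V v) (u ≟V w)
    where
    by-cases : Dec (u ≡ v) → Dec (u ≡ w) →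
               claim (claim s v c) w d u ≡ claim (claim s w d) v c u
    by-cases (yes u≡v) (yes u≡w) = ⊥-elim (v≢w (trans (sym u≡v) u≡w))
    by-cases (yes u≡v) (no u≢w)  =
      trans (claim-≢ _ d u≢w) (trans (claim-≡ s c u≡v) (sym (claim-≡ _ c u≡v)))
    by-cases (no u≢v)  (yes u≡w) =
      trans (claim-≡ _ d u≡w) (sym (trans (claim-≢ _ c u≢v) (claim-≡ s d u≡w)))
    by-cases (no u≢v)  (no u≢w)  =
      trans (claim-≢ _ d u≢w) (trans (claim-≢ s c u≢v)
        (sym (trans (claim-≢ _ c u≢v) (claim-≢ s d u≢w))))

  claim-free-preserves : ∀ s {v} c {u} {e} → s v ≡ free → s u ≡ e → e ≢ free →
                         claim s v c u ≡ e
  claim-free-preserves s {v} c {u} v-free su≡e e≢free with u ≟V v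
  ... | yes refl = ⊥-elim (e≢free (trans (sym su≡e) v-free))
  ... | no _     = su≡e

  claim-keeps-dom : ∀ s v {u} → s u ≡ dom → claim s v dom u ≡ dom
  claim-keeps-dom s v {u} u-dom = by-cases (u ≟V v)
    where
    by-cases : Dec (u ≡ v) → claim s v dom u ≡ dom
    by-cases (yes u≡v) = claim-≡ s dom u≡v
    by-cases (no u≢v)  = trans (claim-≢ s dom u≢v) u-dom

  sta-after-claim : ∀ s v c {u} → claim s v c u ≡ sta → (u ≡ v × c ≡ sta) ⊎ s u ≡ sta
  sta-after-claim s v c {u} u-sta = by-cases (u ≟V v)
    where
    by-cases : Dec (u ≡ v) → (u ≡ v × c ≡ sta) ⊎ s u ≡ sta
    by-cases (yes u≡v) = inj₁ (u≡v , trans (sym (claim-≡ s c u≡v)) u-sta)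
    by-cases (no u≢v)  = inj₂ (trans (sym (claim-≢ s c u≢v)) u-sta)

  sta-after-claim-dom : ∀ s v {u} → claim s v dom u ≡ sta → s u ≡ sta
  sta-after-claim-dom s v {u} u-sta with sta-after-claim s v dom {u} u-sta
  ... | inj₁ (_ , ())
  ... | inj₂ s-sta = s-sta

  sta-after-claim-sta : ∀ s v → (∀ b → s b ≢ sta) → ∀ u → claim s v sta u ≡ sta → u ≡ v
  sta-after-claim-sta s v no-sta u u-sta with sta-after-claim s v sta {u} u-sta
  ... | inj₁ (u≡v , _) = u≡v
  ... | inj₂ s-sta     = ⊥-elim (no-sta u s-sta)

  Near : V → V → Set
  Near b a = b ≡ a ⊎ Adj b a

  near-dominated : ∀ {s : State} {b a} → Near b a → s a ≡ dom →
                   s b ≡ dom ⊎ Σ[ u ∈ V ] (Adj b u × s u ≡ dom)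
  near-dominated             (inj₁ refl) a-dom = inj₁ a-dom
  near-dominated {a = a} (inj₂ b~a)  a-dom = inj₂ (a , b~a , a-dom)

  Reply : (State → Set) → State → V → Set
  Reply P s v = P (claim s v sta)
              ⊎ Σ[ w ∈ V ] (claim s v sta w ≡ free × P (claim (claim s v sta) w dom))

  Reply-map : ∀ {P Q : State → Set} → (∀ {s} → P s → Q s) →
              ∀ {s v} → Reply P s v → Reply Q s v
  Reply-map f (inj₁ p)            = inj₁ (f p)
  Reply-map f (inj₂ (w , w-free , p)) = inj₂ (w , w-free , f p)

  record Invariant : Set₁ where
    field
      Good       : State → Set
      good-empty : Good empty
      good-dom   : ∀ s v → Good s → Good (claim s v dom)
      good-sta   : ∀ s v → Good s → s v ≡ free → Reply Good s v
      good-final : ∀ s → Good s → AllPlayed s → Dominated s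

  record Board : Set where
    field
      unplayed       : State → ℕ
      unplayed-claim : ∀ s v c → s v ≡ free → c ≢ free → unplayed (claim s v c) < unplayed s
      done-or-free   : ∀ s → AllPlayed s ⊎ Σ[ v ∈ V ] s v ≡ free

  invariant⇒outcomeD : Board → Invariant → OutcomeD
  invariant⇒outcomeD board inv =
    dominator-wins _ empty ≤-refl good-empty , staller-wins _ empty ≤-refl good-empty
    where
    open Board board
    open Invariant inv

    dominator-wins : ∀ k s → unplayed s < k → Good s → DomWins s Dominator
    staller-wins   : ∀ k s → unplayed s < k → Good s → DomWins s Staller

    dominator-wins (suc k) s (s≤s u≤k) good with done-or-free s
    ... | inj₁ done       = finished done (good-final s good done)
    ... | inj₂ (v , v-free) =
      dmove v v-free (staller-wins k _ (<-≤-trans (unplayed-claim s v dom v-free λ ()) u≤k)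
                                       (good-dom s v good))

    staller-wins (suc k) s (s≤s u≤k) good with done-or-free s
    ... | inj₁ done     = finished done (good-final s good done)
    ... | inj₂ some-free = smove some-free λ v v-free → respond v v-free (good-sta s v good v-free)
      where
      respond : ∀ v → s v ≡ free → Reply Good s v → DomWins (claim s v sta) Dominator
      respond v v-free (inj₁ good′) =
        dominator-wins k _ (<-≤-trans (unplayed-claim s v sta v-free λ ()) u≤k) good′
      respond v v-free (inj₂ (w , w-free , good′)) =
        dmove w w-free (staller-wins k _
          (<-trans (unplayed-claim _ w dom w-free λ ())
                   (<-≤-trans (unplayed-claim s v sta v-free λ ()) u≤k))
          good′)

  record Matching : Set where
    field
      partner            : V → V
      partner-involutive : ∀ v → partner (partner v) ≡ v

  module Pairing (M : Matching) where
    open Matching M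

    Matched : V → Set
    Matched v = v ≢ partner v

    AllSafe : State → Set
    AllSafe s = ∀ v → Matched v → Safe (s v) (s (partner v))

    partner-swap : ∀ {u v} → partner u ≡ v → u ≡ partner v
    partner-swap {u} eq = trans (sym (partner-involutive u)) (cong partner eq)

    safe-empty : AllSafe empty
    safe-empty _ _ = free-free

    safe-resp : ∀ {s s'} → s ≗ s' → AllSafe s → AllSafe s'
    safe-resp s≗s' safe v m = subst₂ Safe (s≗s' v) (s≗s' (partner v)) (safe v m)

    safe-if-staller-unmatched : ∀ {s} → (∀ u → s u ≡ sta → partner u ≡ u) → AllSafe s
    safe-if-staller-unmatched sta⇒fixed u m =
      safe-non-sta (λ su → m (sym (sta⇒fixed u su)))
                   (λ spu → m (trans (sym (partner-involutive u)) (sta⇒fixed (partner u) spu)))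

    safe-claim : ∀ {s v c} → AllSafe s →
                 (∀ {u} → Matched u → u ≡ v ⊎ partner u ≡ v →
                  Safe (claim s v c u) (claim s v c (partner u))) →
                 AllSafe (claim s v c)
    safe-claim {s} {v} {c} safe at-v u m = by-cases (u ≟V v) (partner u ≟V v)
      where
      by-cases : Dec (u ≡ v) → Dec (partner u ≡ v) →
                 Safe (claim s v c u) (claim s v c (partner u))
      by-cases (yes u≡v) _          = at-v m (inj₁ u≡v)
      by-cases (no _)    (yes pu≡v) = at-v m (inj₂ pu≡v)
      by-cases (no u≢v)  (no pu≢v)  =
        subst₂ Safe (sym (claim-≢ s c u≢v)) (sym (claim-≢ s c pu≢v)) (safe u m)

    safe-claim-dom : ∀ s v → AllSafe s → AllSafe (claim s v dom)
    safe-claim-dom s v safe = safe-claim safe λ where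
      _ (inj₁ u≡v)  → safe-domˡ (claim-≡ s dom u≡v)
      _ (inj₂ pu≡v) → safe-domʳ (claim-≡ s dom pu≡v)

    safe-claim-unmatched : ∀ s v c → partner v ≡ v → AllSafe s → AllSafe (claim s v c)
    safe-claim-unmatched s v c fixed safe = safe-claim safe λ where
      m (inj₁ u≡v)  → ⊥-elim (m (trans u≡v (sym (trans (cong partner u≡v) fixed))))
      m (inj₂ pu≡v) → ⊥-elim (m (trans (partner-swap pu≡v) (trans fixed (sym pu≡v))))

    safe-claim-sta : ∀ s v → s (partner v) ≡ dom → AllSafe s → AllSafe (claim s v sta)
    safe-claim-sta s v pv-dom safe = safe-claim safe λ where
      m (inj₁ u≡v)  → safe-domʳ
        (trans (claim-≢ s sta λ pu≡v → m (trans u≡v (sym pu≡v)))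
               (trans (cong (s ∘ partner) u≡v) pv-dom))
      m (inj₂ pu≡v) → safe-domˡ
        (trans (claim-≢ s sta λ u≡v → m (trans u≡v (sym pu≡v)))
               (trans (cong s (partner-swap pu≡v)) pv-dom))

    safe-played-pair : ∀ {s v} → AllSafe s → AllPlayed s → Matched v →
                       s v ≡ dom ⊎ s (partner v) ≡ dom
    safe-played-pair {s} {v} safe done m = safe-played (safe v m) (done v) (done (partner v))

    pairing-reply : (Q : State → Set) →
                 (∀ {s u c} → s u ≡ free → Matched u → Q s → Q (claim s u c)) →
                 ∀ {s v} → AllSafe s → Q s → s v ≡ free → Matched v →
                 Reply (λ s → AllSafe s × Q s) s v
    pairing-reply Q Q-claim {s} {v} safe q v-free m with s (partner v) in pv
    ... | dom  = inj₁ (safe-claim-sta s v pv safe , Q-claim v-free m q)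
    ... | sta  with subst₂ Safe v-free pv (safe v m)
    ...   | ()
    pairing-reply Q Q-claim {s} {v} safe q v-free m | free =
      inj₂ (partner v , pv-free ,
            safe-resp (sym ∘ claim-comm s sta dom m)
              (safe-claim-sta _ v (claim-≡ s dom refl) (safe-claim-dom s (partner v) safe)) ,
            Q-claim pv-free matched-partner (Q-claim v-free m q))
      where
      pv-free : claim s v sta (partner v) ≡ free
      pv-free = trans (claim-≢ s sta (m ∘ sym)) pv

      matched-partner : Matched (partner v)
      matched-partner e = m (sym (trans e (partner-involutive v)))

record PairingDecomposition (G H : Graph) : Set where
  open Strategy.Matching
  field
    matching        : Strategy.Matching G
    embed           : Graph.V H → Graph.V G
    embed-injective : ∀ {x y} → embed x ≡ embed y → x ≡ y
    embed-adj       : ∀ {x y} → Graph.Adj H x y → Graph.Adj G (embed x) (embed y)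
    embed-unmatched : ∀ x → partner matching (embed x) ≡ embed x
    unmatched-embed : ∀ v → partner matching v ≡ v → Σ[ x ∈ Graph.V H ] embed x ≡ v
    matched-adj     : ∀ v → v ≢ partner matching v → Graph.Adj G v (partner matching v)

module Decomposition {G H : Graph} (D : PairingDecomposition G H)
                     (I : Strategy.Invariant H)
                     (good-resp : ∀ {s s'} → s ≗ s' →
                                  Strategy.Invariant.Good I s → Strategy.Invariant.Good I s') where
  open Graph G
  open Game G
  open Strategy G
  open PairingDecomposition D
  open Matching matching
  open Pairing matching
  private
    module H  = Game H
    module HS = Strategy H
    module I  = HS.Invariant I

  restrict : State → H.State
  restrict s = s ∘ embed

  restrict-claim-embed : ∀ s x c → restrict (claim s (embed x) c) ≗ H.claim (restrict s) x c
  restrict-claim-embed s x c y = by-cases (Graph._≟V_ H y x)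
    where
    by-cases : Dec (y ≡ x) → claim s (embed x) c (embed y) ≡ H.claim (restrict s) x c y
    by-cases (yes y≡x) =
      trans (claim-≡ s c (cong embed y≡x)) (sym (HS.claim-≡ (restrict s) c y≡x))
    by-cases (no y≢x)  =
      trans (claim-≢ s c (y≢x ∘ embed-injective)) (sym (HS.claim-≢ (restrict s) c y≢x))

  restrict-claim-matched : ∀ s v c → Matched v → restrict (claim s v c) ≗ restrict s
  restrict-claim-matched s v c m y =
    claim-≢ s c λ ey≡v → m (sym (trans (cong partner (sym ey≡v)) (trans (embed-unmatched y) ey≡v)))

  data Position : V → Set where
    matched  : ∀ {v} → Matched v → Position v
    embedded : ∀ x → Position (embed x)

  position : ∀ v → Position v
  position v with v ≟V partner v
  ... | no m      = matched m
  ... | yes fixed with unmatched-embed v (sym fixed)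
  ...   | x , refl = embedded x

  Good : State → Set
  Good s = AllSafe s × I.Good (restrict s)

  good-dom : ∀ s v → Good s → Good (claim s v dom)
  good-dom s v (safe , good) with position v
  ... | matched m  = safe-claim-dom s v safe , good-resp (sym ∘ restrict-claim-matched s v dom m) good
  ... | embedded x = safe-claim-dom s (embed x) safe ,
                     good-resp (sym ∘ restrict-claim-embed s x dom) (I.good-dom _ x good)

  good-sta-embedded : ∀ s x → Good s → HS.Reply I.Good (restrict s) x → Reply Good s (embed x)
  good-sta-embedded s x (safe , _) (inj₁ good′) =
    inj₁ (safe-claim-unmatched s (embed x) sta (embed-unmatched x) safe ,
          good-resp (sym ∘ restrict-claim-embed s x sta) good′)
  good-sta-embedded s x (safe , _) (inj₂ (y , y-free , good′)) =
    inj₂ (embed y , trans (restrict-claim-embed s x sta y) y-free ,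
          safe-claim-unmatched _ (embed y) dom (embed-unmatched y)
            (safe-claim-unmatched s (embed x) sta (embed-unmatched x) safe) ,
          good-resp (λ z → sym (trans (restrict-claim-embed s₁ y dom z)
                                      (HS.claim-cong (restrict-claim-embed s x sta) y dom z)))
                    good′)
    where
    s₁ : State
    s₁ = claim s (embed x) sta

  good-sta : ∀ s v → Good s → s v ≡ free → Reply Good s v
  good-sta s v (safe , good) v-free with position v
  ... | matched m =
    pairing-reply (I.Good ∘ restrict)
                  (λ {s} {u} {c} _ m′ → good-resp (sym ∘ restrict-claim-matched s u c m′))
                  safe good v-free m
  ... | embedded x = good-sta-embedded s x (safe , good) (I.good-sta (restrict s) x good v-free)

  good-final : ∀ s → Good s → AllPlayed s → Dominated s
  good-final s (safe , good) done v with position v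
  ... | matched m with safe-played-pair safe done m
  ...   | inj₁ v-dom  = inj₁ v-dom
  ...   | inj₂ pv-dom = inj₂ (partner v , matched-adj v m , pv-dom)
  good-final s (safe , good) done v | embedded x with I.good-final (restrict s) good (done ∘ embed) x
  ...   | inj₁ x-dom             = inj₁ x-dom
  ...   | inj₂ (y , x~y , y-dom) = inj₂ (embed y , embed-adj x~y , y-dom)

  invariant : Invariant
  invariant = record
    { Good       = Good
    ; good-empty = safe-empty , I.good-empty
    ; good-dom   = good-dom
    ; good-sta   = good-sta
    ; good-final = good-final
    }

sumFin : ∀ k → (Fin k → ℕ) → ℕ
sumFin zero    f = 0
sumFin (suc k) f = f zero + sumFin k (f ∘ suc)

sumFin-mono : ∀ k {f g : Fin k → ℕ} → (∀ i → f i ≤ g i) → sumFin k f ≤ sumFin k g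
sumFin-mono zero    f≤g = z≤n
sumFin-mono (suc k) f≤g = +-mono-≤ (f≤g zero) (sumFin-mono k (f≤g ∘ suc))

sumFin-strict : ∀ k {f g : Fin k → ℕ} → (∀ i → f i ≤ g i) → ∀ i → f i < g i →
               sumFin k f < sumFin k g
sumFin-strict (suc k) f≤g zero    fi<gi = +-mono-<-≤ fi<gi (sumFin-mono k (f≤g ∘ suc))
sumFin-strict (suc k) f≤g (suc i) fi<gi = +-mono-≤-< (f≤g zero) (sumFin-strict k (f≤g ∘ suc) i fi<gi)

free? : (c : Cell) → Dec (c ≡ free)
free? free = yes refl
free? dom  = no λ ()
free? sta  = no λ ()

freeIndicator : Cell → ℕ
freeIndicator free = 1
freeIndicator _    = 0

freeIndicator-played : ∀ {c} → c ≢ free → freeIndicator c ≡ 0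
freeIndicator-played {free} c≢free = ⊥-elim (c≢free refl)
freeIndicator-played {dom}  _      = refl
freeIndicator-played {sta}  _      = refl

gridBoard : ∀ m n → Strategy.Board (Grid m n)
gridBoard m n = record
  { unplayed       = unplayed
  ; unplayed-claim = unplayed-claim
  ; done-or-free   = done-or-free
  }
  where
  open Game (Grid m n)
  open Strategy (Grid m n)

  unplayed : State → ℕ
  unplayed s = sumFin m λ i → sumFin n λ j → freeIndicator (s (i , j))

  freeIndicator-claimed : ∀ s v c {u} → c ≢ free → u ≡ v → freeIndicator (claim s v c u) ≡ 0
  freeIndicator-claimed s v c c≢free u≡v =
    trans (cong freeIndicator (claim-≡ s c u≡v)) (freeIndicator-played c≢free)

  freeIndicator-claim : ∀ s v c → c ≢ free → ∀ u →
                        freeIndicator (claim s v c u) ≤ freeIndicator (s u)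
  freeIndicator-claim s v c c≢free u = by-cases (Graph._≟V_ (Grid m n) u v)
    where
    by-cases : Dec (u ≡ v) → freeIndicator (claim s v c u) ≤ freeIndicator (s u)
    by-cases (yes u≡v) = ≤-trans (≤-reflexive (freeIndicator-claimed s v c c≢free u≡v)) z≤n
    by-cases (no u≢v)  = ≤-reflexive (cong freeIndicator (claim-≢ s c u≢v))

  unplayed-claim : ∀ s v c → s v ≡ free → c ≢ free → unplayed (claim s v c) < unplayed s
  unplayed-claim s v@(i , j) c v-free c≢free =
    sumFin-strict m (λ i′ → sumFin-mono n λ j′ → decrease (i′ , j′)) i
      (sumFin-strict n (λ j′ → decrease (i , j′)) j
        (≤-trans (s≤s (≤-reflexive (freeIndicator-claimed s v c c≢free refl)))
                 (≤-reflexive (cong freeIndicator (sym v-free)))))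
    where
    decrease : ∀ u → freeIndicator (claim s v c u) ≤ freeIndicator (s u)
    decrease = freeIndicator-claim s v c c≢free

  done-or-free : ∀ s → AllPlayed s ⊎ Σ[ v ∈ Fin m × Fin n ] s v ≡ free
  done-or-free s with any? (λ i → any? λ j → free? (s (i , j)))
  ... | yes (i , j , v-free) = inj₂ ((i , j) , v-free)
  ... | no none-free         = inj₁ λ (i , j) v-free → none-free (i , j , v-free)

decomposition⇒outcomeD : ∀ {m n H} → PairingDecomposition (Grid m n) H →
                         (I : Strategy.Invariant H) →
                         (∀ {s s'} → s ≗ s' →
                          Strategy.Invariant.Good I s → Strategy.Invariant.Good I s') →
                         OutcomeIsD (Grid m n)
decomposition⇒outcomeD {m} {n} D I good-resp =
  Strategy.invariant⇒outcomeD (Grid m n) (gridBoard m n) (Decomposition.invariant D I good-resp)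

data Even : ℕ → Set where
  even-zero : Even zero
  even-2+   : ∀ {k} → Even k → Even (suc (suc k))

parity : ∀ n → Even n ⊎ Σ[ k ∈ ℕ ] (Even k × n ≡ suc k)
parity zero          = inj₁ even-zero
parity (suc zero)    = inj₂ (zero , even-zero , refl)
parity (suc (suc n)) with parity n
... | inj₁ e              = inj₁ (even-2+ e)
... | inj₂ (k , e , refl) = inj₂ (suc (suc k) , even-2+ e , refl)

PathAdj-suc : ∀ {k} {i j : Fin k} → PathAdj i j → PathAdj (suc i) (suc j)
PathAdj-suc (inj₁ p) = inj₁ (cong suc p)
PathAdj-suc (inj₂ p) = inj₂ (cong suc p)

pathFlip : ∀ {k} → Even k → Fin k → Fin k
pathFlip (even-2+ e) 0F            = 1F
pathFlip (even-2+ e) 1F            = 0F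
pathFlip (even-2+ e) (suc (suc i)) = suc (suc (pathFlip e i))

pathFlip-involutive : ∀ {k} (e : Even k) i → pathFlip e (pathFlip e i) ≡ i
pathFlip-involutive (even-2+ e) 0F            = refl
pathFlip-involutive (even-2+ e) 1F            = refl
pathFlip-involutive (even-2+ e) (suc (suc i)) = cong (λ i → suc (suc i)) (pathFlip-involutive e i)

pathFlip-≢ : ∀ {k} (e : Even k) i → i ≢ pathFlip e i
pathFlip-≢ (even-2+ e) (suc (suc i)) eq = pathFlip-≢ e i (suc-injective (suc-injective eq))

pathFlip-adj : ∀ {k} (e : Even k) i → PathAdj i (pathFlip e i)
pathFlip-adj (even-2+ e) 0F            = inj₁ refl
pathFlip-adj (even-2+ e) 1F            = inj₂ refl
pathFlip-adj (even-2+ e) (suc (suc i)) = PathAdj-suc (PathAdj-suc (pathFlip-adj e i))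

emptyGraph : Graph
emptyGraph = record { V = ⊥ ; _≟V_ = λ () ; Adj = λ _ _ → ⊥ }

emptyInvariant : Strategy.Invariant emptyGraph
emptyInvariant = record
  { Good       = λ _ → ⊤
  ; good-empty = tt
  ; good-dom   = λ _ _ _ → tt
  ; good-sta   = λ _ ()
  ; good-final = λ _ _ _ ()
  }

rowPairing : ∀ {m} n → Even m → PairingDecomposition (Grid m n) emptyGraph
rowPairing n e = record
  { matching        = record
    { partner            = λ (i , j) → pathFlip e i , j
    ; partner-involutive = λ (i , j) → cong (_, j) (pathFlip-involutive e i)
    }
  ; embed           = λ ()
  ; embed-injective = λ {x} → ⊥-elim x
  ; embed-adj       = λ {x} → ⊥-elim x
  ; embed-unmatched = λ ()
  ; unmatched-embed = λ (i , j) fixed → ⊥-elim (pathFlip-≢ e i (sym (cong proj₁ fixed)))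
  ; matched-adj     = λ (i , j) _ → inj₁ (pathFlip-adj e i , refl)
  }

columnPairing : ∀ m {n} → Even n → PairingDecomposition (Grid m n) emptyGraph
columnPairing m e = record
  { matching        = record
    { partner            = λ (i , j) → i , pathFlip e j
    ; partner-involutive = λ (i , j) → cong (i ,_) (pathFlip-involutive e j)
    }
  ; embed           = λ ()
  ; embed-injective = λ {x} → ⊥-elim x
  ; embed-adj       = λ {x} → ⊥-elim x
  ; embed-unmatched = λ ()
  ; unmatched-embed = λ (i , j) fixed → ⊥-elim (pathFlip-≢ e j (sym (cong proj₂ fixed)))
  ; matched-adj     = λ (i , j) _ → inj₂ (refl , pathFlip-adj e j)
  }

even-rows⇒outcomeD : ∀ {m} n → Even m → OutcomeIsD (Grid m n)
even-rows⇒outcomeD n e = decomposition⇒outcomeD (rowPairing n e) emptyInvariant λ _ _ → tt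

even-columns⇒outcomeD : ∀ m {n} → Even n → OutcomeIsD (Grid m n)
even-columns⇒outcomeD m e = decomposition⇒outcomeD (columnPairing m e) emptyInvariant λ _ _ → tt

PathAdj? : ∀ {k} (i j : Fin k) → Dec (PathAdj i j)
PathAdj? i j = (suc (toℕ i) ℕ.≟ toℕ j) ⊎-dec (suc (toℕ j) ℕ.≟ toℕ i)

grid-adj? : ∀ {m n} (u v : Fin m × Fin n) → Dec (Graph.Adj (Grid m n) u v)
grid-adj? (g , h) (g′ , h′) =
  (PathAdj? g g′ ×-dec h Fin.≟ h′) ⊎-dec (g Fin.≟ g′ ×-dec PathAdj? h h′)

Core : Graph
Core = Grid 3 3

CoreVertex : Set
CoreVertex = Fin 3 × Fin 3

open Strategy Core using (Near)

_≟core_ : (a b : CoreVertex) → Dec (a ≡ b)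
_≟core_ = Graph._≟V_ Core

∀-core? : {P : CoreVertex → Set} → (∀ a → Dec (P a)) → Dec (∀ a → P a)
∀-core? P? = map′ (λ h (i , j) → h i j) (λ h i j → h (i , j)) (all? λ i → all? λ j → P? (i , j))

∃-core? : {P : CoreVertex → Set} → (∀ a → Dec (P a)) → Dec (Σ CoreVertex P)
∃-core? P? = map′ (λ (i , j , p) → (i , j) , p) (λ ((i , j) , p) → i , j , p)
                  (any? λ i → any? λ j → P? (i , j))

transposition : CoreVertex × CoreVertex → CoreVertex → CoreVertex
transposition (a , b) v with v ≟core a | v ≟core b
... | yes _ | _     = b
... | no _  | yes _ = a
... | no _  | no _  = v

-- Dominator's strategy on the 3 × 3 grid: when Staller first moves there, at K, he
-- claims answer K and from then on answers inside each pair of corePairs K.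
answer : CoreVertex → CoreVertex
answer (0F , 0F) = 0F , 1F
answer (0F , 1F) = 1F , 0F
answer (0F , 2F) = 0F , 1F
answer (1F , 0F) = 0F , 1F
answer (1F , 1F) = 0F , 1F
answer (1F , 2F) = 0F , 1F
answer (2F , 0F) = 1F , 0F
answer (2F , 1F) = 1F , 0F
answer (2F , 2F) = 1F , 2F

corePairs : CoreVertex → List (CoreVertex × CoreVertex)
corePairs (0F , 0F) = ((1F , 0F) , (1F , 1F)) ∷ ((1F , 2F) , (2F , 2F)) ∷ ((2F , 0F) , (2F , 1F)) ∷ []
corePairs (0F , 1F) = ((0F , 0F) , (1F , 1F)) ∷ ((0F , 2F) , (1F , 2F)) ∷ ((2F , 1F) , (2F , 2F)) ∷ []
corePairs (0F , 2F) = ((1F , 0F) , (1F , 1F)) ∷ ((1F , 2F) , (2F , 2F)) ∷ ((2F , 0F) , (2F , 1F)) ∷ []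
corePairs (1F , 0F) = ((0F , 0F) , (1F , 1F)) ∷ ((1F , 2F) , (2F , 2F)) ∷ ((2F , 0F) , (2F , 1F)) ∷ []
corePairs (1F , 1F) = ((0F , 2F) , (1F , 2F)) ∷ ((1F , 0F) , (2F , 0F)) ∷ ((2F , 1F) , (2F , 2F)) ∷ []
corePairs (1F , 2F) = ((0F , 2F) , (1F , 1F)) ∷ ((1F , 0F) , (2F , 0F)) ∷ ((2F , 1F) , (2F , 2F)) ∷ []
corePairs (2F , 0F) = ((0F , 1F) , (0F , 2F)) ∷ ((1F , 1F) , (1F , 2F)) ∷ ((2F , 1F) , (2F , 2F)) ∷ []
corePairs (2F , 1F) = ((0F , 1F) , (0F , 2F)) ∷ ((1F , 1F) , (2F , 0F)) ∷ ((1F , 2F) , (2F , 2F)) ∷ []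
corePairs (2F , 2F) = ((0F , 0F) , (1F , 1F)) ∷ ((0F , 1F) , (1F , 0F)) ∷ ((2F , 0F) , (2F , 1F)) ∷ []

corePartner : CoreVertex → CoreVertex → CoreVertex
corePartner K = foldr (λ p f → transposition p ∘ f) id (corePairs K)

Near? : ∀ b a → Dec (Near b a)
Near? b a = (b ≟core a) ⊎-dec grid-adj? b a

CoreCovered : CoreVertex → CoreVertex → Set
CoreCovered K b = Near b (answer K)
                ⊎ Σ[ a ∈ CoreVertex ] (a ≢ corePartner K a × Near b a × Near b (corePartner K a))

answer-fresh : ∀ K → answer K ≢ K
answer-fresh = from-yes (∀-core? λ K → ¬? (answer K ≟core K))

corePartner-involutive : ∀ K a → corePartner K (corePartner K a) ≡ a
corePartner-involutive =
  from-yes (∀-core? λ K → ∀-core? λ a → corePartner K (corePartner K a) ≟core a)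

corePartner-opener : ∀ K → corePartner K K ≡ K
corePartner-opener = from-yes (∀-core? λ K → corePartner K K ≟core K)

core-covered : ∀ K b → CoreCovered K b
core-covered = from-yes (∀-core? λ K → ∀-core? λ b →
  Near? b (answer K) ⊎-dec ∃-core? λ a →
    ¬? (a ≟core corePartner K a) ×-dec Near? b a ×-dec Near? b (corePartner K a))

module CoreStrategy where
  open Game Core
  open Strategy Core

  coreMatching : CoreVertex → Matching
  coreMatching K = record { partner = corePartner K ; partner-involutive = corePartner-involutive K }

  module P (K : CoreVertex) = Pairing (coreMatching K)

  CoreGood : State → Set
  CoreGood s = (∀ b → s b ≢ sta) ⊎ Σ[ K ∈ CoreVertex ] (s (answer K) ≡ dom × P.AllSafe K s)

  coreGood-resp : ∀ {s s'} → s ≗ s' → CoreGood s → CoreGood s'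
  coreGood-resp s≗s' (inj₁ no-sta) = inj₁ λ b b-sta → no-sta b (trans (s≗s' b) b-sta)
  coreGood-resp s≗s' (inj₂ (K , answer-dom , safe)) =
    inj₂ (K , trans (sym (s≗s' (answer K))) answer-dom , P.safe-resp K s≗s' safe)

  opening-safe : ∀ {s} K → (∀ u → s u ≡ sta → u ≡ K) → P.AllSafe K s
  opening-safe K only-K = P.safe-if-staller-unmatched K λ u u-sta →
    subst (λ z → corePartner K z ≡ z) (sym (only-K u u-sta)) (corePartner-opener K)

  good-dom : ∀ s v → CoreGood s → CoreGood (claim s v dom)
  good-dom s v (inj₁ no-sta) = inj₁ λ b b-sta → no-sta b (sta-after-claim-dom s v {b} b-sta)
  good-dom s v (inj₂ (K , answer-dom , safe)) =
    inj₂ (K , claim-keeps-dom s v answer-dom , P.safe-claim-dom K s v safe)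

  good-sta-opening : ∀ s K → (∀ b → s b ≢ sta) → Reply CoreGood s K
  good-sta-opening s K no-sta with s (answer K) in answer-state
  ... | free = inj₂ (answer K , trans (claim-≢ s sta (answer-fresh K)) answer-state ,
                     inj₂ (K , claim-≡ (claim s K sta) {answer K} dom refl ,
                           opening-safe K λ u u-sta → sta-after-claim-sta s K no-sta u
                             (sta-after-claim-dom (claim s K sta) (answer K) {u} u-sta)))
  ... | dom  = inj₁ (inj₂ (K , trans (claim-≢ s sta (answer-fresh K)) answer-state ,
                           opening-safe K (sta-after-claim-sta s K no-sta)))
  ... | sta  = ⊥-elim (no-sta (answer K) answer-state)

  good-sta-paired : ∀ s v K → s (answer K) ≡ dom → P.AllSafe K s → s v ≡ free → Reply CoreGood s v
  good-sta-paired s v K answer-dom safe v-free with v ≟core corePartner K v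
  ... | yes fixed =
    inj₁ (inj₂ (K , claim-free-preserves s sta v-free answer-dom (λ ()) ,
                P.safe-claim-unmatched K s v sta (sym fixed) safe))
  ... | no matched =
    Reply-map {P = λ s → P.AllSafe K s × s (answer K) ≡ dom} {Q = CoreGood}
      (λ (safe′ , answer-dom′) → inj₂ (K , answer-dom′ , safe′))
      (P.pairing-reply K (λ s → s (answer K) ≡ dom)
                         (λ {s₁} {u} {c} u-free _ q → claim-free-preserves s₁ c u-free q λ ())
                         safe answer-dom v-free matched)

  good-final : ∀ s → CoreGood s → AllPlayed s → Dominated s
  good-final s (inj₁ no-sta) done b with s b in b-state
  ... | free = ⊥-elim (done b b-state)
  ... | dom  = inj₁ refl
  ... | sta  = ⊥-elim (no-sta b b-state)
  good-final s (inj₂ (K , answer-dom , safe)) done b = covered⇒dominated (core-covered K b)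
    where
    covered⇒dominated : CoreCovered K b →
                        s b ≡ dom ⊎ Σ[ u ∈ CoreVertex ] (Graph.Adj Core b u × s u ≡ dom)
    covered⇒dominated (inj₁ near-answer) = near-dominated near-answer answer-dom
    covered⇒dominated (inj₂ (a , matched , near-a , near-pa))
      with P.safe-played-pair K safe done matched
    ... | inj₁ a-dom  = near-dominated near-a a-dom
    ... | inj₂ pa-dom = near-dominated near-pa pa-dom

  coreInvariant : Invariant
  coreInvariant = record
    { Good       = CoreGood
    ; good-empty = inj₁ λ _ ()
    ; good-dom   = good-dom
    ; good-sta   = λ where
        s v (inj₁ no-sta) _                        → good-sta-opening s v no-sta
        s v (inj₂ (K , answer-dom , safe)) v-free → good-sta-paired s v K answer-dom safe v-free
    ; good-final = good-final
    }

tailFlip : ∀ {k} → Even k → Fin (3 + k) → Fin (3 + k)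
tailFlip e (suc (suc (suc i))) = suc (suc (suc (pathFlip e i)))
tailFlip e i                   = i

tailFlip-involutive : ∀ {k} (e : Even k) i → tailFlip e (tailFlip e i) ≡ i
tailFlip-involutive e 0F                  = refl
tailFlip-involutive e 1F                  = refl
tailFlip-involutive e 2F                  = refl
tailFlip-involutive e (suc (suc (suc i))) = cong (λ i → suc (suc (suc i))) (pathFlip-involutive e i)

tailFlip-↑ˡ : ∀ {k} (e : Even k) (x : Fin 3) → tailFlip e (x ↑ˡ k) ≡ x ↑ˡ k
tailFlip-↑ˡ e 0F = refl
tailFlip-↑ˡ e 1F = refl
tailFlip-↑ˡ e 2F = refl

tailFlip-fixed : ∀ {k} (e : Even k) i → tailFlip e i ≡ i → Σ[ x ∈ Fin 3 ] x ↑ˡ k ≡ i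
tailFlip-fixed e 0F _ = 0F , refl
tailFlip-fixed e 1F _ = 1F , refl
tailFlip-fixed e 2F _ = 2F , refl
tailFlip-fixed e (suc (suc (suc i))) fixed =
  ⊥-elim (pathFlip-≢ e i (sym (suc-injective (suc-injective (suc-injective fixed)))))

PathAdj-+3 : ∀ {k} {i j : Fin k} → PathAdj i j → PathAdj {3 + k} (suc (suc (suc i))) (suc (suc (suc j)))
PathAdj-+3 = PathAdj-suc ∘ PathAdj-suc ∘ PathAdj-suc

tailFlip-adj : ∀ {k} (e : Even k) i → i ≢ tailFlip e i → PathAdj i (tailFlip e i)
tailFlip-adj e 0F moved = ⊥-elim (moved refl)
tailFlip-adj e 1F moved = ⊥-elim (moved refl)
tailFlip-adj e 2F moved = ⊥-elim (moved refl)
tailFlip-adj e (suc (suc (suc i))) _ = PathAdj-+3 (pathFlip-adj e i)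

PathAdj-↑ˡ : ∀ {k n} {i j : Fin k} → PathAdj i j → PathAdj (i ↑ˡ n) (j ↑ˡ n)
PathAdj-↑ˡ {n = n} {i} {j} (inj₁ p) =
  inj₁ (trans (cong suc (toℕ-↑ˡ i n)) (trans p (sym (toℕ-↑ˡ j n))))
PathAdj-↑ˡ {n = n} {i} {j} (inj₂ p) =
  inj₂ (trans (cong suc (toℕ-↑ˡ j n)) (trans p (sym (toℕ-↑ˡ i n))))

oddPartner : ∀ {k l} → Even k → Even l → Fin (3 + k) × Fin (3 + l) → Fin (3 + k) × Fin (3 + l)
oddPartner ek el (suc (suc (suc i)) , j) = suc (suc (suc (pathFlip ek i))) , j
oddPartner ek el (i , j)                 = i , tailFlip el j

oddPairing : ∀ {k l} → Even k → Even l → PairingDecomposition (Grid (3 + k) (3 + l)) Core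
oddPairing {k} {l} ek el = record
  { matching        = record { partner = oddPartner ek el ; partner-involutive = involutive }
  ; embed           = embed
  ; embed-injective = λ {(x , y)} {(x′ , y′)} eq →
      cong₂ _,_ (↑ˡ-injective k x x′ (cong proj₁ eq)) (↑ˡ-injective l y y′ (cong proj₂ eq))
  ; embed-adj       = λ where
      (inj₁ (p , q)) → inj₁ (PathAdj-↑ˡ p , cong (_↑ˡ l) q)
      (inj₂ (p , q)) → inj₂ (cong (_↑ˡ k) p , PathAdj-↑ˡ q)
  ; embed-unmatched = embed-unmatched
  ; unmatched-embed = unmatched-embed
  ; matched-adj     = matched-adj
  }
  where
  embed : CoreVertex → Fin (3 + k) × Fin (3 + l)
  embed (x , y) = x ↑ˡ k , y ↑ˡ l

  involutive : ∀ v → oddPartner ek el (oddPartner ek el v) ≡ v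
  involutive (0F , j) = cong (0F ,_) (tailFlip-involutive el j)
  involutive (1F , j) = cong (1F ,_) (tailFlip-involutive el j)
  involutive (2F , j) = cong (2F ,_) (tailFlip-involutive el j)
  involutive (suc (suc (suc i)) , j) =
    cong (λ i → suc (suc (suc i)) , j) (pathFlip-involutive ek i)

  embed-unmatched : ∀ x → oddPartner ek el (embed x) ≡ embed x
  embed-unmatched (0F , y) = cong (0F ,_) (tailFlip-↑ˡ el y)
  embed-unmatched (1F , y) = cong (1F ,_) (tailFlip-↑ˡ el y)
  embed-unmatched (2F , y) = cong (2F ,_) (tailFlip-↑ˡ el y)

  row-unmatched : ∀ x j → tailFlip el j ≡ j → Σ[ v ∈ CoreVertex ] embed v ≡ (x ↑ˡ k , j)
  row-unmatched x j fixed with tailFlip-fixed el j fixed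
  ... | y , refl = (x , y) , refl

  unmatched-embed : ∀ v → oddPartner ek el v ≡ v → Σ[ x ∈ CoreVertex ] embed x ≡ v
  unmatched-embed (0F , j) fixed = row-unmatched 0F j (cong proj₂ fixed)
  unmatched-embed (1F , j) fixed = row-unmatched 1F j (cong proj₂ fixed)
  unmatched-embed (2F , j) fixed = row-unmatched 2F j (cong proj₂ fixed)
  unmatched-embed (suc (suc (suc i)) , j) fixed =
    ⊥-elim (pathFlip-≢ ek i (sym (suc-injective (suc-injective (suc-injective (cong proj₁ fixed))))))

  matched-adj : ∀ v → v ≢ oddPartner ek el v → Graph.Adj (Grid (3 + k) (3 + l)) v (oddPartner ek el v)
  matched-adj (0F , j) m = inj₂ (refl , tailFlip-adj el j (m ∘ cong (0F ,_)))
  matched-adj (1F , j) m = inj₂ (refl , tailFlip-adj el j (m ∘ cong (1F ,_)))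
  matched-adj (2F , j) m = inj₂ (refl , tailFlip-adj el j (m ∘ cong (2F ,_)))
  matched-adj (suc (suc (suc i)) , j) _ = inj₁ (PathAdj-+3 (pathFlip-adj ek i) , refl)

odd⇒outcomeD : ∀ {k l} → Even k → Even l → OutcomeIsD (Grid (3 + k) (3 + l))
odd⇒outcomeD ek el =
  decomposition⇒outcomeD (oddPairing ek el) CoreStrategy.coreInvariant CoreStrategy.coreGood-resp

theorem3p1 : (m n : ℕ) → 2 ≤ m → m ≤ n → OutcomeIsD (Grid m n)
theorem3p1 m n 2≤m m≤n with parity m | parity n
... | inj₁ even-m                   | _           = even-rows⇒outcomeD n even-m
... | inj₂ _                        | inj₁ even-n = even-columns⇒outcomeD m even-n
... | inj₂ (_ , even-zero , refl)   | _           = ⊥-elim (<-irrefl refl 2≤m)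
... | inj₂ _ | inj₂ (_ , even-zero , refl)       = ⊥-elim (<-irrefl refl (≤-trans 2≤m m≤n))
... | inj₂ (_ , even-2+ ek , refl) | inj₂ (_ , even-2+ el , refl) = odd⇒outcomeD ek el
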